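{- Let $n\ge1$, let $\sigma$ be a permutation of $[2n]$ such that $\sigma(2k-1)\ge2k-1$ and $\sigma(2k)\le2k$ for all $k\in[n]$, and let $i\in[n]$. Then the following are equivalent: (a) $2i-1$ is a record-antirecord of $\sigma$; (b) $2i$ is a record-antirecord of $\sigma$; (c) $\sigma$ maps each of the sets $\{1,\dots,2i-1\}$ and $\{2i,\dots,2n\}$ onto itself; (d) $\sigma$ maps each of the sets $\{1,\dots,2i-2\}$, $\{2i-1\}$, $\{2i\}$ and $\{2i+1,\dots,2n\}$ onto itself.
   Context: An index $j$ of a permutation $\sigma$ is a record if $\sigma(l)<\sigma(j)$ for all $l<j$, an antirecord if $\sigma(l)>\sigma(j)$ for all $l>j$, and a record-antirecord if it is both. -}

module Defs where

open import Data.Nat using (ℕ; zero; suc; _+_; _*_; _∸_; _≤_; _<_)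
open import Data.Fin using (Fin; toℕ)
open import Data.Fin.Permutation using (Permutation′; _⟨$⟩ʳ_)
open import Data.Product using (Σ; _×_)
open import Relation.Binary.PropositionalEquality using (_≡_)

-- Convention: a permutation of [m] = {1,…,m} is a Permutation′ m on Fin m;
-- the element  x : Fin m  stands for the integer  toℕ x + 1  ∈ [m].
-- pos x = the 1-based value represented by x.
pos : {m : ℕ} → Fin m → ℕ
pos x = suc (toℕ x)

val : {m : ℕ} → Permutation′ m → Fin m → ℕ
val σ x = pos (σ ⟨$⟩ʳ x)

IsRecord : {m : ℕ} → Permutation′ m → Fin m → Set
IsRecord σ j = ∀ l → pos l < pos j → val σ l < val σ j

IsAntirecord : {m : ℕ} → Permutation′ m → Fin m → Set
IsAntirecord σ j = ∀ l → pos j < pos l → val σ j < val σ l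

IsRecordAntirecord : {m : ℕ} → Permutation′ m → Fin m → Set
IsRecordAntirecord σ j = IsRecord σ j × IsAntirecord σ j

MapsOnto : {m : ℕ} → Permutation′ m → (ℕ → Set) → Set
MapsOnto {m} σ S =
  (∀ x → S (pos x) → S (val σ x)) ×
  (∀ y → S (pos y) → Σ (Fin m) (λ x → S (pos x) × (σ ⟨$⟩ʳ x ≡ y)))

Interval : ℕ → ℕ → ℕ → Set
Interval a b x = (a ≤ x) × (x ≤ b)

-- Write p = 2i − 1 and q = 2i. Each of the four conditions yields σ(p) < σ(q), which together
-- with the constraints p ≤ σ(p) and σ(q) ≤ q forces σ(p) = p and σ(q) = q. A fixed point j is
-- a record-antirecord exactly when σ maps {1,…,j − 1} onto itself, and for a fixed point j this
-- holds iff σ maps {1,…,j} onto itself. Hence every condition is equivalent to σ mapping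
-- {1,…,p} onto itself.
module Submission where

open import Defs
open import Data.Nat using (ℕ; suc; _+_; _*_; _∸_; _≤_; _<_; z≤n; s≤s)
open import Data.Nat.Properties
open import Data.Fin using (Fin)
open import Data.Fin.Properties using (toℕ-injective; toℕ<n)
open import Data.Fin.Permutation using (Permutation′; _⟨$⟩ʳ_; _⟨$⟩ˡ_; inverseˡ; inverseʳ)
open import Data.Product using (_×_; _,_; proj₁; proj₂)
open import Data.Sum using (_⊎_; [_,_])
import Data.Sum as Sum
open import Function.Base using (_∘_)
open import Function.Bundles using (_⇔_; mk⇔; Equivalence)
open import Function.Construct.Symmetry using (⇔-sym)
open import Function.Construct.Composition using (_⇔-∘_)
open import Relation.Binary.Definitions using (tri<; tri≈; tri>)
open import Relation.Nullary using (¬_; contradiction)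
open import Relation.Binary.PropositionalEquality
  using (_≡_; refl; sym; trans; cong; subst; subst₂; module ≡-Reasoning)

open Equivalence using (to; from)

squeeze : ∀ {t x y} → t ≤ x → x < y → y ≤ suc t → x ≡ t × y ≡ suc t
squeeze {t} {x} {y} t≤x x<y y≤1+t = x≡t , ≤-antisym y≤1+t (subst (λ z → suc z ≤ y) x≡t x<y)
  where
  x≡t : x ≡ t
  x≡t = ≤-antisym (≤-pred (<-≤-trans x<y y≤1+t)) t≤x

pos-injective : ∀ {N} {x y : Fin N} → pos x ≡ pos y → x ≡ y
pos-injective = toℕ-injective ∘ suc-injective

record Preserves {N : ℕ} (σ : Permutation′ N) (S : ℕ → Set) : Set where
  constructor preserving
  field
    at : ∀ x → S (pos x) ⇔ S (val σ x)

open Preserves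

module _ {N : ℕ} (σ : Permutation′ N) where

  val-injective : ∀ {x y} → val σ x ≡ val σ y → x ≡ y
  val-injective {x} {y} eq = begin
    x                         ≡⟨ inverseˡ σ ⟨
    σ ⟨$⟩ˡ (σ ⟨$⟩ʳ x)          ≡⟨ cong (σ ⟨$⟩ˡ_) (pos-injective eq) ⟩
    σ ⟨$⟩ˡ (σ ⟨$⟩ʳ y)          ≡⟨ inverseˡ σ ⟩
    y                         ∎
    where open ≡-Reasoning

  mapsOnto⇔preserves : ∀ S → MapsOnto σ S ⇔ Preserves σ S
  mapsOnto⇔preserves S = mk⇔ preserves mapsOnto
    where
    preserves : MapsOnto σ S → Preserves σ S
    preserves (forth , onto) = preserving λ x → mk⇔ (forth x) (back x)
      where
      back : ∀ x → S (val σ x) → S (pos x)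
      back x Sσx with onto (σ ⟨$⟩ʳ x) Sσx
      ... | x′ , Sx′ , σx′≡σx = subst (S ∘ pos) (val-injective (cong pos σx′≡σx)) Sx′

    mapsOnto : Preserves σ S → MapsOnto σ S
    mapsOnto p = (λ x → to (at p x)) , λ y Sy →
      σ ⟨$⟩ˡ y , from (at p (σ ⟨$⟩ˡ y)) (subst (S ∘ pos) (sym (inverseʳ σ)) Sy) , inverseʳ σ

  preserves-cong : ∀ S T → (∀ (y : Fin N) → S (pos y) ⇔ T (pos y)) →
                   Preserves σ S → Preserves σ T
  preserves-cong _ _ S⇔T p = preserving λ x → S⇔T (σ ⟨$⟩ʳ x) ⇔-∘ (at p x ⇔-∘ ⇔-sym (S⇔T x))

  preserves-¬ : ∀ {S} → Preserves σ S → Preserves σ (¬_ ∘ S)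
  preserves-¬ p = preserving λ x → mk⇔ (λ ¬S Sσ → ¬S (from (at p x) Sσ)) (λ ¬Sσ S → ¬Sσ (to (at p x) S))

  preserves-⊎ : ∀ {S T} → Preserves σ S → Preserves σ T → Preserves σ (λ n → S n ⊎ T n)
  preserves-⊎ p q = preserving λ x →
    mk⇔ (Sum.map (to (at p x)) (to (at q x))) (Sum.map (from (at p x)) (from (at q x)))

  preserves-× : ∀ {S T} → Preserves σ S → Preserves σ T → Preserves σ (λ n → S n × T n)
  preserves-× p q = preserving λ x →
    mk⇔ (λ (s , t) → to (at p x) s , to (at q x) t) (λ (s , t) → from (at p x) s , from (at q x) t)

  preserves-singleton⇔fixed : ∀ {j t} → pos j ≡ t → Preserves σ (_≡ t) ⇔ (val σ j ≡ t)
  preserves-singleton⇔fixed {j} {t} pj = mk⇔ (λ p → to (at p j) pj) preserves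
    where
    preserves : val σ j ≡ t → Preserves σ (_≡ t)
    preserves vj = preserving λ x → mk⇔
      (λ px → subst (λ z → val σ z ≡ t) (pos-injective (trans pj (sym px))) vj)
      (λ vx → subst (λ z → pos z ≡ t) (val-injective (trans vj (sym vx))) pj)

  mapsOnto-singleton⇔fixed : ∀ {j t} → pos j ≡ t → MapsOnto σ (_≡ t) ⇔ (val σ j ≡ t)
  mapsOnto-singleton⇔fixed pj = preserves-singleton⇔fixed pj ⇔-∘ mapsOnto⇔preserves _

  mapsOnto-initial⇔preserves : ∀ {t} → MapsOnto σ (Interval 1 t) ⇔ Preserves σ (_< suc t)
  mapsOnto-initial⇔preserves {t} =
    mk⇔ (preserves-cong (Interval 1 t) (_< suc t) initial⇔< ∘ to (mapsOnto⇔preserves _))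
        (from (mapsOnto⇔preserves _) ∘ preserves-cong (_< suc t) (Interval 1 t) (⇔-sym ∘ initial⇔<))
    where
    initial⇔< : ∀ (y : Fin N) → Interval 1 t (pos y) ⇔ pos y < suc t
    initial⇔< y = mk⇔ (s≤s ∘ proj₂) (λ y<1+t → s≤s z≤n , ≤-pred y<1+t)

  mapsOnto-final⇔preserves : ∀ {t} → MapsOnto σ (Interval t N) ⇔ Preserves σ (_< t)
  mapsOnto-final⇔preserves {t} =
    mk⇔ (preserves-cong (¬_ ∘ (t ≤_)) (_< t) (λ _ → mk⇔ ≰⇒> <⇒≱) ∘ preserves-¬ ∘
         preserves-cong (Interval t N) (t ≤_) final⇔≥ ∘ to (mapsOnto⇔preserves _))
        (from (mapsOnto⇔preserves _) ∘ preserves-cong (¬_ ∘ (_< t)) (Interval t N) ≮⇔final ∘ preserves-¬)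
    where
    final⇔≥ : ∀ (y : Fin N) → Interval t N (pos y) ⇔ t ≤ pos y
    final⇔≥ y = mk⇔ proj₁ (λ t≤y → t≤y , toℕ<n y)

    ≮⇔final : ∀ (y : Fin N) → (¬ pos y < t) ⇔ Interval t N (pos y)
    ≮⇔final y = mk⇔ (λ y≮t → ≮⇒≥ y≮t , toℕ<n y) (≤⇒≯ ∘ proj₁)

  recordAntirecord⇔ : ∀ {j} → IsRecordAntirecord σ j ⇔ (∀ x → pos x < pos j ⇔ val σ x < val σ j)
  recordAntirecord⇔ {j} = mk⇔ (λ ra x → mk⇔ (proj₁ ra x) (back ra x)) (λ f → (λ x → to (f x)) , anti f)
    where
    back : IsRecordAntirecord σ j → ∀ x → val σ x < val σ j → pos x < pos j
    back (_ , antirecord) x vx<vj with <-cmp (pos x) (pos j)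
    ... | tri< px<pj _ _ = px<pj
    ... | tri≈ _ px≡pj _ = contradiction (subst (λ z → val σ z < val σ j) (pos-injective px≡pj) vx<vj) (n≮n _)
    ... | tri> _ _ pj<px = contradiction (antirecord x pj<px) (<-asym vx<vj)

    anti : (∀ x → pos x < pos j ⇔ val σ x < val σ j) → IsAntirecord σ j
    anti f x pj<px with <-cmp (val σ x) (val σ j)
    ... | tri< vx<vj _ _ = contradiction (from (f x) vx<vj) (<-asym pj<px)
    ... | tri≈ _ vx≡vj _ = contradiction (subst (λ z → pos j < pos z) (val-injective vx≡vj) pj<px) (n≮n _)
    ... | tri> _ _ vj<vx = vj<vx

  recordAntirecord⇔preserves : ∀ {j t} → pos j ≡ t → val σ j ≡ t →
                               IsRecordAntirecord σ j ⇔ Preserves σ (_< t)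
  recordAntirecord⇔preserves {j} {t} pj vj = mk⇔ (preserving ∘ to at-fixed) (from at-fixed ∘ at)
    where
    at-fixed : IsRecordAntirecord σ j ⇔ (∀ x → pos x < t ⇔ val σ x < t)
    at-fixed = subst₂ (λ p v → IsRecordAntirecord σ j ⇔ (∀ x → pos x < p ⇔ val σ x < v)) pj vj recordAntirecord⇔

  preserves-<⇔preserves-<suc : ∀ {j t} → pos j ≡ t → val σ j ≡ t →
                               Preserves σ (_< t) ⇔ Preserves σ (_< suc t)
  preserves-<⇔preserves-<suc {j} {t} pj vj = mk⇔
    (λ p → preserves-cong _ (_< suc t) <∨≡⇔<suc (preserves-⊎ p singleton))
    (λ p → preserves-cong _ (_< t) <suc∧≢⇔< (preserves-× p (preserves-¬ singleton)))
    where
    singleton : Preserves σ (_≡ t)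
    singleton = from (preserves-singleton⇔fixed pj) vj

    <∨≡⇔<suc : ∀ (y : Fin N) → (pos y < t ⊎ pos y ≡ t) ⇔ pos y < suc t
    <∨≡⇔<suc y = mk⇔ [ m<n⇒m<1+n , ≤-reflexive ∘ cong suc ] m<1+n⇒m<n∨m≡n

    <suc∧≢⇔< : ∀ (y : Fin N) → (pos y < suc t × ¬ pos y ≡ t) ⇔ pos y < t
    <suc∧≢⇔< y = mk⇔ (λ (y<1+t , y≢t) → ≤∧≢⇒< (≤-pred y<1+t) y≢t) (λ y<t → m<n⇒m<1+n y<t , <⇒≢ y<t)

module AdjacentPair {N : ℕ} (σ : Permutation′ N) {m : ℕ} {a b : Fin N}
  (pa : pos a ≡ suc m) (pb : pos b ≡ suc (suc m))
  (a-rises : suc m ≤ val σ a) (b-falls : val σ b ≤ suc (suc m)) where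

  Fixed : Set
  Fixed = val σ a ≡ suc m × val σ b ≡ suc (suc m)

  Splits : Set
  Splits = Preserves σ (_< suc (suc m))

  Halves : Set
  Halves = MapsOnto σ (Interval 1 (suc m)) × MapsOnto σ (Interval (suc (suc m)) N)

  Blocks : Set
  Blocks = MapsOnto σ (Interval 1 m) × MapsOnto σ (_≡ suc m) ×
           MapsOnto σ (_≡ suc (suc m)) × MapsOnto σ (Interval (suc (suc (suc m))) N)

  fixed-of-< : val σ a < val σ b → Fixed
  fixed-of-< va<vb = squeeze a-rises va<vb b-falls

  a<b : pos a < pos b
  a<b = subst₂ _<_ (sym pa) (sym pb) ≤-refl

  splits⇒fixed : Splits → Fixed
  splits⇒fixed s = fixed-of-< (<-≤-trans va<q q≤vb)
    where
    va<q : val σ a < suc (suc m)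
    va<q = to (at s a) (≤-reflexive (cong suc pa))

    q≤vb : suc (suc m) ≤ val σ b
    q≤vb = ≮⇒≥ (λ vb<q → <-irrefl pb (from (at s b) vb<q))

  recordAntirecord-a⇔splits : IsRecordAntirecord σ a ⇔ Splits
  recordAntirecord-a⇔splits = mk⇔
    (λ ra → let va = proj₁ (fixed-of-< (proj₂ ra b a<b)) in
            to (preserves-<⇔preserves-<suc σ pa va) (to (recordAntirecord⇔preserves σ pa va) ra))
    (λ s → let va = proj₁ (splits⇒fixed s) in
           from (recordAntirecord⇔preserves σ pa va) (from (preserves-<⇔preserves-<suc σ pa va) s))

  recordAntirecord-b⇔splits : IsRecordAntirecord σ b ⇔ Splits
  recordAntirecord-b⇔splits = mk⇔
    (λ rb → to (recordAntirecord⇔preserves σ pb (proj₂ (fixed-of-< (proj₁ rb a a<b)))) rb)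
    (λ s → from (recordAntirecord⇔preserves σ pb (proj₂ (splits⇒fixed s))) s)

  halves⇔splits : Halves ⇔ Splits
  halves⇔splits = mk⇔
    (to (mapsOnto-initial⇔preserves σ) ∘ proj₁)
    (λ s → from (mapsOnto-initial⇔preserves σ) s , from (mapsOnto-final⇔preserves σ) s)

  blocks⇔splits : Blocks ⇔ Splits
  blocks⇔splits = mk⇔ splits blocks
    where
    splits : Blocks → Splits
    splits (initial , singleton-a , _) =
      to (preserves-<⇔preserves-<suc σ pa (to (mapsOnto-singleton⇔fixed σ pa) singleton-a))
         (to (mapsOnto-initial⇔preserves σ) initial)

    blocks : Splits → Blocks
    blocks s with splits⇒fixed s
    ... | va , vb =
      from (mapsOnto-initial⇔preserves σ) (from (preserves-<⇔preserves-<suc σ pa va) s) ,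
      from (mapsOnto-singleton⇔fixed σ pa) va ,
      from (mapsOnto-singleton⇔fixed σ pb) vb ,
      from (mapsOnto-final⇔preserves σ) (to (preserves-<⇔preserves-<suc σ pb vb) s)

-- The positions p, q, r are abstracted because 2i − 1, 2i and 2i + 1 are not syntactically
-- successors of one another.
adjacentPair-equivalences : ∀ {N} (σ : Permutation′ N) {m p q r : ℕ} →
  p ≡ suc m → q ≡ suc p → r ≡ suc q → {a b : Fin N} → pos a ≡ p → pos b ≡ q →
  p ≤ val σ a → val σ b ≤ q →
  (IsRecordAntirecord σ a ⇔ IsRecordAntirecord σ b) ×
  (IsRecordAntirecord σ b ⇔ (MapsOnto σ (Interval 1 p) × MapsOnto σ (Interval q N))) ×
  ((MapsOnto σ (Interval 1 p) × MapsOnto σ (Interval q N)) ⇔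
   (MapsOnto σ (Interval 1 m) × MapsOnto σ (_≡ p) × MapsOnto σ (_≡ q) × MapsOnto σ (Interval r N)))
adjacentPair-equivalences σ refl refl refl pa pb a-rises b-falls =
  ⇔-sym recordAntirecord-b⇔splits ⇔-∘ recordAntirecord-a⇔splits ,
  ⇔-sym halves⇔splits ⇔-∘ recordAntirecord-b⇔splits ,
  ⇔-sym blocks⇔splits ⇔-∘ halves⇔splits
  where open AdjacentPair σ pa pb a-rises b-falls

odd≡suc-pred : ∀ j → 2 * suc j ∸ 1 ≡ suc (2 * suc j ∸ 2)
odd≡suc-pred j rewrite +-suc j (j + 0) = refl

lemma3p2 : (n : ℕ) → 1 ≤ n → (σ : Permutation′ (2 * n)) →
    (∀ (x : Fin (2 * n)) (k : ℕ) → 1 ≤ k → k ≤ n →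
       (pos x ≡ 2 * k ∸ 1 → 2 * k ∸ 1 ≤ val σ x) ×
       (pos x ≡ 2 * k → val σ x ≤ 2 * k)) →
    (i : ℕ) → 1 ≤ i → i ≤ n →
    (a b : Fin (2 * n)) → pos a ≡ 2 * i ∸ 1 → pos b ≡ 2 * i →
    (IsRecordAntirecord σ a ⇔ IsRecordAntirecord σ b) ×
    (IsRecordAntirecord σ b ⇔
       (MapsOnto σ (Interval 1 (2 * i ∸ 1)) × MapsOnto σ (Interval (2 * i) (2 * n)))) ×
    ((MapsOnto σ (Interval 1 (2 * i ∸ 1)) × MapsOnto σ (Interval (2 * i) (2 * n))) ⇔
       (MapsOnto σ (Interval 1 (2 * i ∸ 2)) × MapsOnto σ (_≡ 2 * i ∸ 1) ×
        MapsOnto σ (_≡ 2 * i) × MapsOnto σ (Interval (2 * i + 1) (2 * n))))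
lemma3p2 n _ σ constraint (suc j) 1≤i i≤n a b pa pb =
  adjacentPair-equivalences σ (odd≡suc-pred j) refl (+-comm (2 * suc j) 1) pa pb
    (proj₁ (constraint a (suc j) 1≤i i≤n) pa) (proj₂ (constraint b (suc j) 1≤i i≤n) pb)
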